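{- Let $m\ge1$, $n\ge2$ and $T,T'\in\mathrm{Bi}(m,n)$. Then $T$ and $T'$ are isomorphic if and only if their subtrees of internal vertices $T_i$ and $T_i'$ are isomorphic.
   Context: $\mathrm{Bi}(m,n)$ denotes the set of finite trees all of whose vertices have valence $1$ or $n$ and which have exactly $m$ vertices of valence $n$. Internal vertices are those of valence $>1$; the subtree of internal vertices has as vertices the internal vertices and as edges the edges of the tree between two internal vertices. -}

module Defs where

open import Data.Nat using (ℕ; zero; suc; _<_; _≟_)
open import Data.Bool using (Bool; true; false; if_then_else_)
open import Data.Fin using (Fin; zero; suc; inject₁; fromℕ)
open import Data.List using (List; length; filter; map; allFin)
open import Data.Nat.ListAction using (sum)
open import Data.Product using (Σ; _×_; proj₁; ∃)
open import Data.Sum using (_⊎_)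
open import Relation.Binary.PropositionalEquality using (_≡_)
open import Relation.Nullary using (¬_)
open import Function.Bundles using (_↔_; _⇔_; Inverse)
open import Function.Definitions using (Injective)
open import Level using (0ℓ)

record FinGraph : Set where
  field
    size   : ℕ
    adj    : Fin size → Fin size → Bool
    sym    : ∀ i j → adj i j ≡ adj j i
    irrefl : ∀ i → adj i i ≡ false

open FinGraph public

Adj : (G : FinGraph) → Fin (size G) → Fin (size G) → Set
Adj G i j = adj G i j ≡ true

deg : (G : FinGraph) → Fin (size G) → ℕ
deg G v = sum (map (λ w → if adj G v w then 1 else 0) (allFin (size G)))

data Walk (G : FinGraph) : Fin (size G) → Fin (size G) → Set where
  here : ∀ {u} → Walk G u u
  step : ∀ {u v w} → Adj G u v → Walk G v w → Walk G u w

Connected : FinGraph → Set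
Connected G = ∀ u v → Walk G u v

record Cycle (G : FinGraph) : Set where
  field
    len    : ℕ
    vert   : Fin (suc (suc (suc len))) → Fin (size G)
    inj    : Injective _≡_ _≡_ vert
    consec : ∀ (i : Fin (suc (suc len))) → Adj G (vert (inject₁ i)) (vert (suc i))
    close  : Adj G (vert (fromℕ (suc (suc len)))) (vert zero)

Acyclic : FinGraph → Set
Acyclic G = ¬ Cycle G

IsTree : FinGraph → Set
IsTree G = Connected G × Acyclic G

countDeg : (G : FinGraph) → ℕ → ℕ
countDeg G n = length (filter (λ v → deg G v ≟ n) (allFin (size G)))

Bi : ℕ → ℕ → FinGraph → Set
Bi m n T = IsTree T × (∀ v → deg T v ≡ 1 ⊎ deg T v ≡ n) × countDeg T n ≡ m

record Graph : Set₁ where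
  field
    V : Set
    E : V → V → Set

open Graph public

toGraph : FinGraph → Graph
toGraph G = record { V = Fin (size G) ; E = Adj G }

Isomorphic : Graph → Graph → Set
Isomorphic A B = Σ (V A ↔ V B) λ f →
  ∀ x y → E A x y ⇔ E B (Inverse.to f x) (Inverse.to f y)

Internal : (G : FinGraph) → Fin (size G) → Set
Internal G v = 1 < deg G v

internalSubtree : FinGraph → Graph
internalSubtree G = record
  { V = Σ (Fin (size G)) (Internal G)
  ; E = λ x y → Adj G (proj₁ x) (proj₁ y) }

{-# OPTIONS --safe #-}
-- A tree in Bi(m,n) is its internal subtree with pendant leaves attached,
-- and the leaves hanging at an internal vertex v number n minus the degree
-- of v in the internal subtree.  So an isomorphism of internal subtrees
-- matches the leaf bundles up in size, and extends bijectively leaf by leaf;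
-- conversely an isomorphism of trees preserves valences, hence restricts.
module Submission where

open import Defs renaming (sym to adj-sym)
open import Data.Nat using (ℕ; zero; suc; _+_; _≤_; _<_; _<?_; _≟_)
open import Data.Nat.Properties using (≤-irrelevant; ≡-irrelevant; <-irrefl; +-cancelˡ-≡)
open import Data.Bool using (Bool; true; false; if_then_else_)
import Data.Bool as Bool
open import Data.Fin using (Fin; zero; suc)
open import Data.Fin.Properties using (+↔⊎)
open import Data.Fin.Permutation using (↔⇒≡)
open import Data.List using (List; _∷_; length; filter; map; tabulate; allFin)
open import Data.List.Properties using (map-tabulate; tabulate-cong)
open import Data.Nat.ListAction using (sum)
open import Data.Product using (Σ; ∃; _×_; _,_; proj₁; proj₂)
open import Data.Product.Algebra using (Σ-assoc-alt)
open import Data.Product.Function.Dependent.Propositional using (Σ-↔)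
open import Data.Sum using (_⊎_; inj₁; inj₂; [_,_]′)
open import Data.Sum.Function.Propositional using (_⊎-↔_)
open import Data.Empty using (⊥; ⊥-elim)
open import Function using (_∘_; id)
open import Function.Bundles using (_↔_; _⇔_; Inverse; Equivalence; Injection; mk↔ₛ′; mk⇔)
open import Function.Properties.Inverse using (↔-refl; ↔-sym; ↔-trans; ↔⇒↣)
open import Function.Construct.Identity using (⇔-id)
open import Function.Construct.Symmetry using (⇔-sym)
open import Function.Construct.Composition using (_⇔-∘_)
open import Function.Related.Propositional using (module EquationalReasoning)
open import Relation.Binary.PropositionalEquality
open import Relation.Nullary using (Dec; yes; no; does; ¬_; Irrelevant)
open import Relation.Nullary.Decidable using (_×-dec_)
open import Relation.Unary using (Decidable)
open import Axiom.UniquenessOfIdentityProofs using (module Decidable⇒UIP)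

open Inverse using (to; from)

Finite : Set → Set
Finite A = ∃ λ k → A ↔ Fin k

×-irrelevant : {A B : Set} → Irrelevant A → Irrelevant B → Irrelevant (A × B)
×-irrelevant irrA irrB (a , b) (a' , b') = cong₂ _,_ (irrA a a') (irrB b b')

⇔⇒↔ : {A B : Set} → Irrelevant A → Irrelevant B → A ⇔ B → A ↔ B
⇔⇒↔ irrA irrB A⇔B =
  mk↔ₛ′ (Equivalence.to A⇔B) (Equivalence.from A⇔B) (λ _ → irrB _ _) (λ _ → irrA _ _)

to-≡-⇔ : {A B : Set} (f : A ↔ B) {x y : A} → x ≡ y ⇔ to f x ≡ to f y
to-≡-⇔ f = mk⇔ (cong (to f)) (Injection.injective (↔⇒↣ f))

↔Fin1⇒≡ : {A : Set} → A ↔ Fin 1 → (x y : A) → x ≡ y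
↔Fin1⇒≡ e x y = Injection.injective (↔⇒↣ e) (trans (Fin1-≡ (to e x)) (sym (Fin1-≡ (to e y))))
  where
  Fin1-≡ : (i : Fin 1) → i ≡ zero
  Fin1-≡ zero = refl

Dec-↔-Fin : {A : Set} (a? : Dec A) → Irrelevant A → A ↔ Fin (if does a? then 1 else 0)
Dec-↔-Fin (yes a) irr = mk↔ₛ′ (λ _ → zero) (λ _ → a) (λ { zero → refl }) (irr a)
Dec-↔-Fin (no ¬a) _   = mk↔ₛ′ (⊥-elim ∘ ¬a) (λ ()) (λ ()) (⊥-elim ∘ ¬a)

Σ-Fin-suc-↔ : ∀ {a} {P : Fin (suc a) → Set} → Σ (Fin (suc a)) P ↔ (P zero ⊎ Σ (Fin a) (P ∘ suc))
Σ-Fin-suc-↔ {P = P} = mk↔ₛ′ split join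
  (λ { (inj₁ _) → refl ; (inj₂ _) → refl })
  (λ { (zero , _) → refl ; (suc _ , _) → refl })
  where
  split : Σ (Fin _) P → P zero ⊎ Σ (Fin _) (P ∘ suc)
  split (zero  , p) = inj₁ p
  split (suc x , p) = inj₂ (x , p)
  join : P zero ⊎ Σ (Fin _) (P ∘ suc) → Σ (Fin _) P
  join (inj₁ p)       = zero , p
  join (inj₂ (x , p)) = suc x , p

count : ∀ {a} → (Fin a → Bool) → ℕ
count b = sum (tabulate (λ x → if b x then 1 else 0))

Σ-↔-Fin-count : ∀ {a} {P : Fin a → Set} (P? : Decidable P) → (∀ {x} → Irrelevant (P x)) →
  Σ (Fin a) P ↔ Fin (count (does ∘ P?))
Σ-↔-Fin-count {zero}  P? irr = mk↔ₛ′ (λ ()) (λ ()) (λ ()) (λ ())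
Σ-↔-Fin-count {suc a} {P} P? irr = begin
  Σ (Fin (suc a)) P              ↔⟨ Σ-Fin-suc-↔ ⟩
  (P zero ⊎ Σ (Fin a) (P ∘ suc)) ↔⟨ Dec-↔-Fin (P? zero) irr ⊎-↔ Σ-↔-Fin-count (P? ∘ suc) irr ⟩
  (Fin _ ⊎ Fin _)                ↔⟨ ↔-sym +↔⊎ ⟩
  Fin _                          ∎
  where open EquationalReasoning

Σ-Fin-finite : ∀ {a} {P : Fin a → Set} → Decidable P → (∀ {x} → Irrelevant (P x)) → Finite (Σ (Fin a) P)
Σ-Fin-finite P? irr = _ , Σ-↔-Fin-count P? irr

finite-⊎-cancelˡ : {A A' B B' : Set} → Finite A → Finite B → Finite B' →
  A ↔ A' → (A ⊎ B) ↔ (A' ⊎ B') → B ↔ B'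
finite-⊎-cancelˡ {A} {A'} {B} {B'} (k , A↔k) (j , B↔j) (j' , B'↔j') A↔A' A⊎B↔A'⊎B' =
  ↔-trans B↔j (subst (λ i → Fin i ↔ B') (sym j≡j') (↔-sym B'↔j'))
  where
  open EquationalReasoning
  j≡j' : j ≡ j'
  j≡j' = +-cancelˡ-≡ k j j' (↔⇒≡ (begin
    Fin (k + j)      ↔⟨ +↔⊎ ⟩
    (Fin k ⊎ Fin j)  ↔⟨ ↔-sym A↔k ⊎-↔ ↔-sym B↔j ⟩
    (A ⊎ B)          ↔⟨ A⊎B↔A'⊎B' ⟩
    (A' ⊎ B')        ↔⟨ ↔-trans (↔-sym A↔A') A↔k ⊎-↔ B'↔j' ⟩
    (Fin k ⊎ Fin j') ↔⟨ ↔-sym +↔⊎ ⟩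
    Fin (k + j')     ∎))

Σ-⊎-split : {A : Set} {P Q R : A → Set} → (∀ x → P x ⊎ Q x) → (∀ {x} → P x → Q x → ⊥) →
  (∀ {x} → Irrelevant (P x)) → (∀ {x} → Irrelevant (Q x)) →
  Σ A R ↔ (Σ A (λ x → P x × R x) ⊎ Σ A (λ x → Q x × R x))
Σ-⊎-split {A} {P} {Q} {R} P⊎Q disjoint irrP irrQ = mk↔ₛ′ split join split-join join-split
  where
  Target : Set
  Target = Σ A (λ x → P x × R x) ⊎ Σ A (λ x → Q x × R x)
  sort : ∀ x → P x ⊎ Q x → R x → Target
  sort x (inj₁ p) r = inj₁ (x , p , r)
  sort x (inj₂ q) r = inj₂ (x , q , r)
  split : Σ A R → Target
  split (x , r) = sort x (P⊎Q x) r
  join : Target → Σ A R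
  join (inj₁ (x , _ , r)) = x , r
  join (inj₂ (x , _ , r)) = x , r
  join-split : ∀ y → join (split y) ≡ y
  join-split (x , r) with P⊎Q x
  ... | inj₁ _ = refl
  ... | inj₂ _ = refl
  split-join : ∀ z → split (join z) ≡ z
  split-join (inj₁ (x , p , r)) with P⊎Q x
  ... | inj₁ p' = cong (λ p → inj₁ (x , p , r)) (irrP p' p)
  ... | inj₂ q  = ⊥-elim (disjoint p q)
  split-join (inj₂ (x , q , r)) with P⊎Q x
  ... | inj₁ p  = ⊥-elim (disjoint p q)
  ... | inj₂ q' = cong (λ q → inj₂ (x , q , r)) (irrQ q' q)

∃-of-filter : {A : Set} {P : A → Set} (P? : Decidable P) (xs : List A) → 1 ≤ length (filter P? xs) → ∃ P
∃-of-filter P? (x ∷ xs) nonempty with P? x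
... | yes p = x , p
... | no _  = ∃-of-filter P? xs nonempty

Nbrs : (G : Graph) → V G → Set
Nbrs G x = Σ (V G) (E G x)

iso-sym : {A B : Graph} → Isomorphic A B → Isomorphic B A
iso-sym {A} {B} (f , f-adj) = ↔-sym f , λ x y →
  ⇔-sym (subst₂ (λ x' y' → E A (from f x) (from f y) ⇔ E B x' y')
    (Inverse.strictlyInverseˡ f x) (Inverse.strictlyInverseˡ f y) (f-adj (from f x) (from f y)))

iso-trans : {A B C : Graph} → Isomorphic A B → Isomorphic B C → Isomorphic A C
iso-trans (f , f-adj) (g , g-adj) = ↔-trans f g , λ x y → g-adj (to f x) (to f y) ⇔-∘ f-adj x y

nbrs-↔ : {A B : Graph} (φ : Isomorphic A B) →
  (∀ {x y} → Irrelevant (E A x y)) → (∀ {x y} → Irrelevant (E B x y)) →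
  ∀ x → Nbrs A x ↔ Nbrs B (to (proj₁ φ) x)
nbrs-↔ (f , f-adj) irrA irrB x = Σ-↔ f (⇔⇒↔ irrA irrB (f-adj x _))

Adj-irrelevant : ∀ G {i j} → Irrelevant (Adj G i j)
Adj-irrelevant G = Decidable⇒UIP.≡-irrelevant Bool._≟_

Adj? : ∀ G i → Decidable (Adj G i)
Adj? G i j = adj G i j Bool.≟ true

Adj-sym : ∀ G {i j} → Adj G i j → Adj G j i
Adj-sym G {i} {j} a = trans (adj-sym G j i) a

deg≡count : ∀ G v → deg G v ≡ count (does ∘ Adj? G v)
deg≡count G v = begin
  sum (map indicator (tabulate id)) ≡⟨ cong sum (map-tabulate id indicator) ⟩
  sum (tabulate indicator)          ≡⟨ cong sum (tabulate-cong (indicator-does ∘ adj G v)) ⟩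
  count (does ∘ Adj? G v)           ∎
  where
  open ≡-Reasoning
  indicator : Fin (size G) → ℕ
  indicator w = if adj G v w then 1 else 0
  indicator-does : (b : Bool) → (if b then 1 else 0) ≡ (if does (b Bool.≟ true) then 1 else 0)
  indicator-does true  = refl
  indicator-does false = refl

nbrs-↔-deg : ∀ G v → Nbrs (toGraph G) v ↔ Fin (deg G v)
nbrs-↔-deg G v = subst (λ k → Nbrs (toGraph G) v ↔ Fin k) (sym (deg≡count G v))
  (Σ-↔-Fin-count (Adj? G v) (Adj-irrelevant G))

iso-preserves-deg : ∀ {G H} (φ : Isomorphic (toGraph G) (toGraph H)) v → deg G v ≡ deg H (to (proj₁ φ) v)
iso-preserves-deg {G} {H} φ v = ↔⇒≡ (begin
  Fin (deg G v)      ↔⟨ ↔-sym (nbrs-↔-deg G v) ⟩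
  Nbrs (toGraph G) v ↔⟨ nbrs-↔ {toGraph G} {toGraph H} φ (Adj-irrelevant G) (Adj-irrelevant H) v ⟩
  Nbrs (toGraph H) _ ↔⟨ nbrs-↔-deg H _ ⟩
  Fin (deg H _)      ∎)
  where open EquationalReasoning

internalSubtree-iso : ∀ {G H} → Isomorphic (toGraph G) (toGraph H) →
  Isomorphic (internalSubtree G) (internalSubtree H)
internalSubtree-iso {G} {H} φ@(f , f-adj) =
  Σ-↔ f (λ {v} → subst (λ k → Internal G v ↔ 1 < k) (iso-preserves-deg {G} {H} φ v) ↔-refl) ,
  λ x y → f-adj (proj₁ x) (proj₁ y)

walk-invariant : ∀ G (S : Fin (size G) → Set) → (∀ {a b} → S a → Adj G a b → S b) →
  ∀ {a b} → Walk G a b → S a → S b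
walk-invariant G S closed here       s = s
walk-invariant G S closed (step e w) s = walk-invariant G S closed w (closed s e)

pendantEdge : (H : Graph) (P : V H → Set) → V H ⊎ Σ (V H) P → V H ⊎ Σ (V H) P → Set
pendantEdge H P (inj₁ a)       (inj₁ b)       = E H a b
pendantEdge H P (inj₁ a)       (inj₂ (b , _)) = a ≡ b
pendantEdge H P (inj₂ (a , _)) (inj₁ b)       = a ≡ b
pendantEdge H P (inj₂ _)       (inj₂ _)       = ⊥

attachPendants : (H : Graph) → (V H → Set) → Graph
attachPendants H P = record { V = V H ⊎ Σ (V H) P ; E = pendantEdge H P }

attachPendants-cong : {H H' : Graph} {P : V H → Set} {P' : V H' → Set} (φ : Isomorphic H H') →
  (∀ a → P a ↔ P' (to (proj₁ φ) a)) → Isomorphic (attachPendants H P) (attachPendants H' P')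
attachPendants-cong {H} {H'} {P} {P'} (f , f-adj) ψ = vertices , edges
  where
  vertices : (V H ⊎ Σ (V H) P) ↔ (V H' ⊎ Σ (V H') P')
  vertices = f ⊎-↔ Σ-↔ f (λ {a} → ψ a)
  edges : ∀ x y → pendantEdge H P x y ⇔ pendantEdge H' P' (to vertices x) (to vertices y)
  edges (inj₁ a)       (inj₁ b)       = f-adj a b
  edges (inj₁ a)       (inj₂ (b , _)) = to-≡-⇔ f
  edges (inj₂ (a , _)) (inj₁ b)       = to-≡-⇔ f
  edges (inj₂ _)       (inj₂ _)       = ⇔-id ⊥

module BiTree {m n : ℕ} (m≥1 : 1 ≤ m) (n≥2 : 2 ≤ n) {T : FinGraph} (T∈Bi : Bi m n T) where

  Leaf : Fin (size T) → Set
  Leaf u = deg T u ≡ 1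

  Core : Graph
  Core = internalSubtree T

  InternalVertex : Set
  InternalVertex = V Core

  Pendant : InternalVertex → Set
  Pendant v = Σ (Fin (size T)) λ u → Leaf u × Adj T (proj₁ v) u

  InternalNbrs : InternalVertex → Set
  InternalNbrs v = Σ (Fin (size T)) λ u → Internal T u × Adj T (proj₁ v) u

  private
    connected : Connected T
    connected = proj₁ (proj₁ T∈Bi)

    valence : ∀ u → deg T u ≡ 1 ⊎ deg T u ≡ n
    valence = proj₁ (proj₂ T∈Bi)

    hub : ∃ λ h → deg T h ≡ n
    hub = ∃-of-filter (λ u → deg T u ≟ n) (allFin (size T)) (subst (1 ≤_) (sym (proj₂ (proj₂ T∈Bi))) m≥1)

  internal-or-leaf : ∀ u → Internal T u ⊎ Leaf u
  internal-or-leaf u = [ inj₂ , (λ d → inj₁ (subst (1 <_) (sym d) n≥2)) ]′ (valence u)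

  leaf⇒¬internal : ∀ {u} → Leaf u → ¬ Internal T u
  leaf⇒¬internal l p = <-irrefl refl (subst (1 <_) l p)

  internal-deg : ∀ {u} → Internal T u → deg T u ≡ n
  internal-deg p = [ (λ l → ⊥-elim (leaf⇒¬internal l p)) , id ]′ (valence _)

  internal-≡ : {v w : InternalVertex} → proj₁ v ≡ proj₁ w → v ≡ w
  internal-≡ {u , p} {.u , q} refl = cong (u ,_) (≤-irrelevant p q)

  module _ {u : Fin (size T)} (l : Leaf u) where
    private
      nbrs-↔-Fin1 : Nbrs (toGraph T) u ↔ Fin 1
      nbrs-↔-Fin1 = subst (λ k → Nbrs (toGraph T) u ↔ Fin k) l (nbrs-↔-deg T u)

      neighbour : Nbrs (toGraph T) u
      neighbour = from nbrs-↔-Fin1 zero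

    parent : Fin (size T)
    parent = proj₁ neighbour

    parent-adj : Adj T u parent
    parent-adj = proj₂ neighbour

    parent-unique : ∀ {w} → Adj T u w → w ≡ parent
    parent-unique a = cong proj₁ (↔Fin1⇒≡ nbrs-↔-Fin1 (_ , a) neighbour)

  -- Two adjacent leaves would form a whole connected component, missing the
  -- vertex of valence n that m ≥ 1 provides.
  parent-internal : ∀ {u} (l : Leaf u) → Internal T (parent l)
  parent-internal {u} l = [ id , (λ l' → ⊥-elim (isolated l')) ]′ (internal-or-leaf (parent l))
    where
    S : Fin (size T) → Set
    S x = x ≡ u ⊎ x ≡ parent l
    closed : Leaf (parent l) → ∀ {a b} → S a → Adj T a b → S b
    closed l' (inj₁ refl) a = inj₂ (parent-unique l a)
    closed l' (inj₂ refl) a = inj₁ (trans (parent-unique l' a) (sym (parent-unique l' (Adj-sym T (parent-adj l)))))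
    S⇒leaf : Leaf (parent l) → ∀ {x} → S x → Leaf x
    S⇒leaf l' (inj₁ refl) = l
    S⇒leaf l' (inj₂ refl) = l'
    isolated : Leaf (parent l) → ⊥
    isolated l' = leaf⇒¬internal
      (S⇒leaf l' (walk-invariant T S (closed l') (connected u (proj₁ hub)) (inj₁ refl)))
      (subst (1 <_) (sym (proj₂ hub)) n≥2)

  parentᴵ : ∀ {u} → Leaf u → InternalVertex
  parentᴵ l = parent l , parent-internal l

  Decomposed : Graph
  Decomposed = attachPendants Core Pendant

  classify : ∀ u → Internal T u ⊎ Leaf u → V Decomposed
  classify u (inj₁ p) = inj₁ (u , p)
  classify u (inj₂ l) = inj₂ (parentᴵ l , u , l , Adj-sym T (parent-adj l))

  vertex : V Decomposed → Fin (size T)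
  vertex (inj₁ (u , _))     = u
  vertex (inj₂ (_ , u , _)) = u

  vertex-classify : ∀ u k → vertex (classify u k) ≡ u
  vertex-classify u (inj₁ _) = refl
  vertex-classify u (inj₂ _) = refl

  classify-vertex : ∀ x k → classify (vertex x) k ≡ x
  classify-vertex (inj₁ (u , p))         (inj₁ p') = cong (λ q → inj₁ (u , q)) (≤-irrelevant p' p)
  classify-vertex (inj₁ (u , p))         (inj₂ l)  = ⊥-elim (leaf⇒¬internal l p)
  classify-vertex (inj₂ (_ , u , l , _)) (inj₁ p)  = ⊥-elim (leaf⇒¬internal l p)
  classify-vertex (inj₂ (v , u , l , a)) (inj₂ l') =
    cong inj₂ (pendant-≡ (sym (parent-unique l' (Adj-sym T a))))
    where
    pendant-≡ : ∀ {v v' : InternalVertex}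
      {x : Leaf u × Adj T (proj₁ v) u} {x' : Leaf u × Adj T (proj₁ v') u} →
      proj₁ v ≡ proj₁ v' → _≡_ {A = Σ InternalVertex Pendant} (v , u , x) (v' , u , x')
    pendant-≡ {w , p} {.w , p'} {x} {x'} refl
      rewrite ≤-irrelevant p p' | ×-irrelevant ≡-irrelevant (Adj-irrelevant T) x x' = refl

  classify-adj : ∀ x y kx ky → Adj T x y ⇔ pendantEdge Core Pendant (classify x kx) (classify y ky)
  classify-adj x y (inj₁ _) (inj₁ _) = ⇔-id (Adj T x y)
  classify-adj x y (inj₁ p) (inj₂ l) = mk⇔
    (λ a → internal-≡ (parent-unique l (Adj-sym T a)))
    (λ e → subst (λ z → Adj T z y) (cong proj₁ (sym e)) (Adj-sym T (parent-adj l)))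
  classify-adj x y (inj₂ l) (inj₁ p) = mk⇔
    (λ a → internal-≡ (sym (parent-unique l a)))
    (λ e → subst (Adj T x) (cong proj₁ e) (parent-adj l))
  classify-adj x y (inj₂ l) (inj₂ l') = mk⇔
    (λ a → leaf⇒¬internal l' (subst (Internal T) (sym (parent-unique l a)) (parent-internal l)))
    ⊥-elim

  decomposition : Isomorphic (toGraph T) Decomposed
  decomposition =
    mk↔ₛ′ (λ u → classify u (internal-or-leaf u)) vertex
      (λ x → classify-vertex x (internal-or-leaf (vertex x)))
      (λ u → vertex-classify u (internal-or-leaf u)) ,
    λ x y → classify-adj x y (internal-or-leaf x) (internal-or-leaf y)

  neighbourhood-split : ∀ v → Fin n ↔ (InternalNbrs v ⊎ Pendant v)
  neighbourhood-split (u , p) = begin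
    Fin n                                    ↔⟨ subst (λ k → Fin n ↔ Fin k) (sym (internal-deg p)) ↔-refl ⟩
    Fin (deg T u)                            ↔⟨ ↔-sym (nbrs-↔-deg T u) ⟩
    Nbrs (toGraph T) u                       ↔⟨ Σ-⊎-split internal-or-leaf (λ q l → leaf⇒¬internal l q)
                                                  ≤-irrelevant ≡-irrelevant ⟩
    (InternalNbrs (u , p) ⊎ Pendant (u , p)) ∎
    where open EquationalReasoning

  nbrs-core-↔ : ∀ v → Nbrs Core v ↔ InternalNbrs v
  nbrs-core-↔ v = Σ-assoc-alt

  internalNbrs-finite : ∀ v → Finite (InternalNbrs v)
  internalNbrs-finite v = Σ-Fin-finite (λ u → (1 <? deg T u) ×-dec Adj? T (proj₁ v) u)
    (×-irrelevant ≤-irrelevant (Adj-irrelevant T))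

  pendant-finite : ∀ v → Finite (Pendant v)
  pendant-finite v = Σ-Fin-finite (λ u → (deg T u ≟ 1) ×-dec Adj? T (proj₁ v) u)
    (×-irrelevant ≡-irrelevant (Adj-irrelevant T))

module _ {m n : ℕ} (m≥1 : 1 ≤ m) (n≥2 : 2 ≤ n) {T T' : FinGraph} (T∈Bi : Bi m n T) (T'∈Bi : Bi m n T') where

  private
    module A = BiTree m≥1 n≥2 T∈Bi
    module B = BiTree m≥1 n≥2 T'∈Bi

  pendant-↔ : (φ : Isomorphic A.Core B.Core) → ∀ v → A.Pendant v ↔ B.Pendant (to (proj₁ φ) v)
  pendant-↔ φ v = finite-⊎-cancelˡ (A.internalNbrs-finite v) (A.pendant-finite v) (B.pendant-finite v')
    internal-nbrs (↔-trans (↔-sym (A.neighbourhood-split v)) (B.neighbourhood-split v'))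
    where
    v' : B.InternalVertex
    v' = to (proj₁ φ) v
    internal-nbrs : A.InternalNbrs v ↔ B.InternalNbrs v'
    internal-nbrs = ↔-trans (↔-sym (A.nbrs-core-↔ v))
      (↔-trans (nbrs-↔ {A.Core} {B.Core} φ (Adj-irrelevant T) (Adj-irrelevant T') v) (B.nbrs-core-↔ v'))

  internalSubtree-iso⁻¹ : Isomorphic A.Core B.Core → Isomorphic (toGraph T) (toGraph T')
  internalSubtree-iso⁻¹ φ =
    iso-trans {B = A.Decomposed} {C = toGraph T'} A.decomposition
      (iso-trans {B = B.Decomposed} {C = toGraph T'} (attachPendants-cong {A.Core} {B.Core} φ (pendant-↔ φ))
        (iso-sym {toGraph T'} B.decomposition))

corollary3p9 : (m n : ℕ) → 1 ≤ m → 2 ≤ n → (T T' : FinGraph) → Bi m n T → Bi m n T' →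
    Isomorphic (toGraph T) (toGraph T') ⇔ Isomorphic (internalSubtree T) (internalSubtree T')
corollary3p9 m n m≥1 n≥2 T T' T∈Bi T'∈Bi =
  mk⇔ (internalSubtree-iso {T} {T'}) (internalSubtree-iso⁻¹ m≥1 n≥2 T∈Bi T'∈Bi)
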